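{- Let $(E,r)$ be a $q$-matroid and let $\mathcal{Z}$ be a lattice (under inclusion) of subspaces of $E$ satisfying (Z1) $r(0_{\mathcal{Z}})=0$; (Z2) for all $F,G\in\mathcal{Z}$ with $G<F$: $0<r(F)-r(G)<\dim F-\dim G$; (Z3) for all $F,G\in\mathcal{Z}$: $r(F)+r(G)\ge r(F\vee G)+r(F\wedge G)+\dim((F\cap G)/(F\wedge G))$, where $\vee,\wedge,0_{\mathcal{Z}}$ are the join, meet and least element of $\mathcal{Z}$. For $A\le E$ define $r_{\mathcal{Z}}(A)=\min\{r(F)+\dim((A+F)/F):F\in\mathcal{Z}\}$. Then $r_{\mathcal{Z}}$ satisfies (R1)–(R3), i.e. $(E,r_{\mathcal{Z}})$ is a $q$-matroid.
   Context: $q$ is a prime power and $E$ an $n$-dimensional $\mathbb{F}_q$-vector space. A $q$-matroid $(E,\rho)$ is a function $\rho$ from subspaces of $E$ to $\mathbb{Z}$ satisfying (R1) $0\le\rho(A)\le\dim A$; (R2) $\rho(A)\le\rho(B)$ whenever $A\le B$; (R3) $\rho(A+B)+\rho(A\cap B)\le\rho(A)+\rho(B)$. -}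

module Defs where

open import Data.Nat as ℕ using (ℕ; zero; suc; _∸_)
open import Data.Integer as ℤ using (ℤ; +_; _+_; _-_; _≤_; _<_)
open import Data.Bool using (Bool; true; false; if_then_else_; _∧_)
open import Data.List using (List; []; _∷_; _++_; length; map; concatMap; filter)
open import Data.Bool.ListAction using (any)
import Data.List.NonEmpty
open import Data.List.NonEmpty using (List⁺; toList; foldr₁)
open import Data.List.Membership.Propositional using (_∈_)
open import Data.Vec as Vec using (Vec; []; _∷_; zipWith; replicate)
open import Data.Vec.Properties using (≡-dec)
open import Data.Product using (Σ; _×_; _,_)
open import Relation.Binary.PropositionalEquality using (_≡_)
open import Relation.Binary.Definitions using (DecidableEquality)
open import Relation.Nullary using (¬_; does)
open import Relation.Nullary.Decidable using (T?)
open import Algebra.Structures using (IsCommutativeRing)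

record FiniteField : Set₁ where
  field
    Carrier : Set
    _⊕_ _⊗_ : Carrier → Carrier → Carrier
    ⊖_ : Carrier → Carrier
    0# 1# : Carrier
    isCommutativeRing : IsCommutativeRing _≡_ _⊕_ _⊗_ ⊖_ 0# 1#
    0≢1 : ¬ (0# ≡ 1#)
    inv : (x : Carrier) → ¬ (x ≡ 0#) → Carrier
    inv-correct : (x : Carrier) (p : ¬ (x ≡ 0#)) → x ⊗ inv x p ≡ 1#
    _≟_ : DecidableEquality Carrier
    enum : List Carrier
    enum-complete : (x : Carrier) → x ∈ enum

  q : ℕ
  q = length enum

module VS (K : FiniteField) (n : ℕ) where
  open FiniteField K

  V : Set
  V = Vec Carrier n

  allVecs : (m : ℕ) → List (Vec Carrier m)
  allVecs zero = [] ∷ []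
  allVecs (suc m) = concatMap (λ x → map (x ∷_) (allVecs m)) enum

  0V : V
  0V = replicate n 0#

  _+V_ : V → V → V
  _+V_ = zipWith _⊕_

  _·V_ : Carrier → V → V
  c ·V v = Vec.map (c ⊗_) v

  -_V : V → V
  -_V = Vec.map ⊖_

  _≟V_ : DecidableEquality V
  _≟V_ = ≡-dec _≟_

  lincomb : (B : List V) → Vec Carrier (length B) → V
  lincomb [] [] = 0V
  lincomb (b ∷ B) (c ∷ cs) = (c ·V b) +V lincomb B cs

  inSpan : List V → V → Bool
  inSpan B v = any (λ cs → does (lincomb B cs ≟V v)) (allVecs (length B))

  greedyBasis : List V → List V → List V
  greedyBasis acc [] = acc
  greedyBasis acc (v ∷ vs) =
    if inSpan acc v then greedyBasis acc vs else greedyBasis (v ∷ acc) vs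

  -- A subspace of E is represented by a finite list of generators;
  -- it stands for their span.  Every subspace of E arises this way.
  record Subspace : Set where
    constructor ⟨_⟩
    field
      gens : List V
  open Subspace public

  mem : Subspace → V → Bool
  mem A v = inSpan (gens A) v

  dim : Subspace → ℕ
  dim A = length (greedyBasis [] (gens A))

  _⊆_ : Subspace → Subspace → Set
  A ⊆ B = ∀ v → mem A v ≡ true → mem B v ≡ true

  _⊂_ : Subspace → Subspace → Set
  A ⊂ B = A ⊆ B × ¬ (B ⊆ A)

  _≐_ : Subspace → Subspace → Set
  A ≐ B = A ⊆ B × B ⊆ A

  0S : Subspace
  0S = ⟨ [] ⟩

  _+S_ : Subspace → Subspace → Subspace
  A +S B = ⟨ gens A ++ gens B ⟩

  _∩S_ : Subspace → Subspace → Subspace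
  A ∩S B = ⟨ filter (λ v → T? (mem A v ∧ mem B v)) (allVecs n) ⟩

  -- dim (A / B) for B ≤ A
  dimQuot : Subspace → Subspace → ℕ
  dimQuot A B = dim A ∸ dim B

  -- a rank function must be a function of the subspace (not of the
  -- chosen generators)
  Extensional : (Subspace → ℤ) → Set
  Extensional ρ = ∀ A B → A ≐ B → ρ A ≡ ρ B

  record IsQMatroid (ρ : Subspace → ℤ) : Set where
    field
      R1 : ∀ A → (+ 0 ≤ ρ A) × (ρ A ≤ + dim A)
      R2 : ∀ A B → A ⊆ B → ρ A ≤ ρ B
      R3 : ∀ A B → ρ (A +S B) + ρ (A ∩S B) ≤ ρ A + ρ B

  _∈Z_ : Subspace → List⁺ Subspace → Set
  F ∈Z Z = F ∈ toList Z

  IsJoin : List⁺ Subspace → Subspace → Subspace → Subspace → Set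
  IsJoin Z F G J = J ∈Z Z × F ⊆ J × G ⊆ J
    × (∀ H → H ∈Z Z → F ⊆ H → G ⊆ H → J ⊆ H)

  IsMeet : List⁺ Subspace → Subspace → Subspace → Subspace → Set
  IsMeet Z F G M = M ∈Z Z × M ⊆ F × M ⊆ G
    × (∀ H → H ∈Z Z → H ⊆ F → H ⊆ G → H ⊆ M)

  IsBottom : List⁺ Subspace → Subspace → Set
  IsBottom Z B = B ∈Z Z × (∀ H → H ∈Z Z → B ⊆ H)

  IsLattice : List⁺ Subspace → Set
  IsLattice Z = ∀ F G → F ∈Z Z → G ∈Z Z →
    Σ Subspace (λ J → IsJoin Z F G J) × Σ Subspace (λ M → IsMeet Z F G M)

  rZ : (Subspace → ℤ) → List⁺ Subspace → Subspace → ℤ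
  rZ r Z A = foldr₁ ℤ._⊓_ (Data.List.NonEmpty.map (λ F → r F + + dimQuot (A +S F) F) Z)

module Submission where

-- These are nonnegative
-- and grow with A, giving (R1) from below and (R2); the least element 0_Z of the finite
-- lattice Z has r(0_Z) = 0 by (Z1), and its bound gives r_Z(A) ≤ dim A.  For (R3), let F
-- and G attain r_Z(A) and r_Z(B), and bound r_Z(A+B) and r_Z(A∩B) through J = F ∨ G and
-- M = F ∧ G.  (Z3) then reduces (R3) to the linear-algebra inequality
--   dim((A+B+J)/J) + dim((A∩B+M)/M) ≤ dim((A+F)/F) + dim((B+G)/G) + dim((F∩G)/M),
-- which follows from Grassmann's formula applied to F, G and to A+F, B+G.  Dimension is
-- the size of a greedily extracted basis; the Steinitz exchange lemma makes it the size
-- of every basis, from which Grassmann's formula follows.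

open import Defs
open import Data.Nat as ℕ using (ℕ; suc)
import Data.Nat.Properties as ℕ
open import Data.Nat.Tactic.RingSolver using (solve-∀)
open import Data.Bool using (true; false; _∧_)
open import Data.List using (List; []; _∷_; _++_; length; map)
open import Data.List.Properties using (++-assoc; length-++)
open import Data.List.Relation.Unary.All as All using (All; []; _∷_)
open import Data.List.Relation.Unary.All.Properties using (++⁺)
open import Data.List.Relation.Unary.Any as Any using (here; there)
open import Data.List.Relation.Unary.Any.Properties using (any⁺; any⁻)
open import Data.List.Membership.Propositional using (_∈_; lose)
open import Data.List.Membership.Propositional.Properties
  using (∈-map⁺; ∈-map⁻; ∈-concatMap⁺; ∈-filter⁺; ∈-filter⁻; ∈-++⁺ˡ; ∈-++⁺ʳ)
open import Data.Vec as Vec using (Vec; []; _∷_; zipWith; replicate)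
open import Data.Vec.Properties
  using (zipWith-assoc; zipWith-comm; zipWith-identityˡ; map-cong; map-∘; map-id; map-const; map-replicate)
open import Data.Product using (Σ; ∃; _×_; _,_; proj₁; proj₂; uncurry)
open import Data.Sum using (_⊎_; inj₁; inj₂)
open import Data.Empty using (⊥-elim)
open import Data.Integer using (ℤ; +_; _+_; _-_; _≤_; _<_; _⊓_; +≤+; 0ℤ)
import Data.Integer.Properties as ℤ
open import Data.Integer.Tactic.RingSolver as ℤ-Solver using ()
open import Data.List.NonEmpty as List⁺ using (List⁺; _∷_; foldr₁)
open import Function using (_∘_; Equivalence; case_of_)
open import Relation.Binary.PropositionalEquality
open import Relation.Nullary using (¬_; Dec; yes; no; does)
open import Relation.Nullary.Decidable using (T?; map′; dec-true)
open import Data.Bool.Properties using (T-≡; T-∧)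
open import Algebra.Bundles using (CommutativeSemigroup)
open import Algebra.Structures using (IsCommutativeRing)
import Algebra.Properties.CommutativeSemigroup as CommutativeSemigroupProperties

module _ {a} {A : Set a} where

  map-zipWith : ∀ {m} {f : A → A} {g : A → A → A} → (∀ x y → f (g x y) ≡ g (f x) (f y)) →
                (xs ys : Vec A m) → Vec.map f (zipWith g xs ys) ≡ zipWith g (Vec.map f xs) (Vec.map f ys)
  map-zipWith homo []       []       = refl
  map-zipWith homo (x ∷ xs) (y ∷ ys) = cong₂ _∷_ (homo x y) (map-zipWith homo xs ys)

  zipWith-map-map : ∀ {b} {B : Set b} {m} (g : B → B → B) (f h : A → B) (xs : Vec A m) →
                    zipWith g (Vec.map f xs) (Vec.map h xs) ≡ Vec.map (λ x → g (f x) (h x)) xs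
  zipWith-map-map g f h []       = refl
  zipWith-map-map g f h (x ∷ xs) = cong (_ ∷_) (zipWith-map-map g f h xs)

foldr₁-⊓-≤ : ∀ y ys {x} → x ∈ y ∷ ys → foldr₁ _⊓_ (y ∷ ys) ≤ x
foldr₁-⊓-≤ y []       (here refl) = ℤ.≤-refl
foldr₁-⊓-≤ y (z ∷ zs) (here refl) = ℤ.i⊓j≤i y _
foldr₁-⊓-≤ y (z ∷ zs) (there x∈)  = ℤ.≤-trans (ℤ.i⊓j≤j y _) (foldr₁-⊓-≤ z zs x∈)

foldr₁-⊓-∈ : ∀ y ys → foldr₁ _⊓_ (y ∷ ys) ∈ y ∷ ys
foldr₁-⊓-∈ y []       = here refl
foldr₁-⊓-∈ y (z ∷ zs) with ℤ.⊓-sel y (foldr₁ _⊓_ (z ∷ zs))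
... | inj₁ y⊓≡y   = here y⊓≡y
... | inj₂ y⊓≡min = there (subst (_∈ z ∷ zs) (sym y⊓≡min) (foldr₁-⊓-∈ z zs))

module LinearAlgebra (K : FiniteField) (n : ℕ) where
  open FiniteField K
  open VS K n
  private module R = IsCommutativeRing isCommutativeRing

  +V-assoc : ∀ u v w → (u +V v) +V w ≡ u +V (v +V w)
  +V-assoc = zipWith-assoc R.+-assoc

  +V-comm : ∀ u v → u +V v ≡ v +V u
  +V-comm = zipWith-comm R.+-comm

  +V-identityˡ : ∀ u → 0V +V u ≡ u
  +V-identityˡ = zipWith-identityˡ R.+-identityˡ

  +V-identityʳ : ∀ u → u +V 0V ≡ u
  +V-identityʳ u = trans (+V-comm u 0V) (+V-identityˡ u)

  +V-commutativeSemigroup : CommutativeSemigroup _ _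
  +V-commutativeSemigroup = record
    { isCommutativeSemigroup = record
      { isSemigroup = record { isMagma = isMagma _+V_ ; assoc = +V-assoc }
      ; comm = +V-comm
      }
    }

  open CommutativeSemigroupProperties +V-commutativeSemigroup
    using () renaming (interchange to +V-interchange)

  ·V-distribˡ : ∀ c u v → c ·V (u +V v) ≡ (c ·V u) +V (c ·V v)
  ·V-distribˡ c = map-zipWith (R.distribˡ c)

  ·V-distribʳ : ∀ a b u → (a ⊕ b) ·V u ≡ (a ·V u) +V (b ·V u)
  ·V-distribʳ a b u =
    trans (map-cong (λ x → R.distribʳ x a b) u) (sym (zipWith-map-map _⊕_ (a ⊗_) (b ⊗_) u))

  ·V-assoc : ∀ a b u → a ·V (b ·V u) ≡ (a ⊗ b) ·V u
  ·V-assoc a b u = trans (sym (map-∘ (a ⊗_) (b ⊗_) u)) (map-cong (λ x → sym (R.*-assoc a b x)) u)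

  ·V-identityˡ : ∀ u → 1# ·V u ≡ u
  ·V-identityˡ u = trans (map-cong R.*-identityˡ u) (map-id u)

  ·V-zeroˡ : ∀ u → 0# ·V u ≡ 0V
  ·V-zeroˡ u = trans (map-cong R.zeroˡ u) (map-const u 0#)

  ·V-zeroʳ : ∀ c → c ·V 0V ≡ 0V
  ·V-zeroʳ c = trans (map-replicate (c ⊗_) 0# n) (cong (replicate n) (R.zeroʳ c))

  -1·V-cancelˡ : ∀ w v → ((⊖ 1#) ·V w) +V (w +V v) ≡ v
  -1·V-cancelˡ w v = begin
    ((⊖ 1#) ·V w) +V (w +V v)          ≡⟨ +V-assoc _ w v ⟨
    (((⊖ 1#) ·V w) +V w) +V v          ≡⟨ cong (λ x → (((⊖ 1#) ·V w) +V x) +V v) (·V-identityˡ w) ⟨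
    (((⊖ 1#) ·V w) +V (1# ·V w)) +V v  ≡⟨ cong (_+V v) (·V-distribʳ (⊖ 1#) 1# w) ⟨
    (((⊖ 1#) ⊕ 1#) ·V w) +V v          ≡⟨ cong (λ c → (c ·V w) +V v) (R.-‿inverseˡ 1#) ⟩
    (0# ·V w) +V v                     ≡⟨ cong (_+V v) (·V-zeroˡ w) ⟩
    0V +V v                            ≡⟨ +V-identityˡ v ⟩
    v                                  ∎
    where open ≡-Reasoning

  record Span (L : List V) (v : V) : Set where
    constructor mkSpan
    field
      coeffs   : Vec Carrier (length L)
      lincomb≡ : lincomb L coeffs ≡ v

  span-0V : ∀ L → Span L 0V
  span-0V []      = mkSpan [] refl
  span-0V (u ∷ L) with mkSpan cs eq ← span-0V L =
    mkSpan (0# ∷ cs) (trans (cong₂ _+V_ (·V-zeroˡ u) eq) (+V-identityˡ 0V))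

  span-+V : ∀ {L x y} → Span L x → Span L y → Span L (x +V y)
  span-+V {[]}    (mkSpan [] refl) (mkSpan [] refl) = mkSpan [] (sym (+V-identityˡ 0V))
  span-+V {u ∷ L} (mkSpan (c ∷ cs) refl) (mkSpan (d ∷ ds) refl)
    with mkSpan es eq ← span-+V {L} (mkSpan cs refl) (mkSpan ds refl) = mkSpan ((c ⊕ d) ∷ es) (begin
      ((c ⊕ d) ·V u) +V lincomb L es                          ≡⟨ cong₂ _+V_ (·V-distribʳ c d u) eq ⟩
      ((c ·V u) +V (d ·V u)) +V (lincomb L cs +V lincomb L ds) ≡⟨ +V-interchange _ _ _ _ ⟩
      ((c ·V u) +V lincomb L cs) +V ((d ·V u) +V lincomb L ds) ∎)
    where open ≡-Reasoning

  span-·V : ∀ {L x} c → Span L x → Span L (c ·V x)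
  span-·V {[]}    c (mkSpan [] refl) = mkSpan [] (sym (·V-zeroʳ c))
  span-·V {u ∷ L} c (mkSpan (d ∷ ds) refl)
    with mkSpan es eq ← span-·V {L} c (mkSpan ds refl) = mkSpan ((c ⊗ d) ∷ es) (begin
      ((c ⊗ d) ·V u) +V lincomb L es          ≡⟨ cong₂ _+V_ (·V-assoc c d u) (sym eq) ⟨
      (c ·V (d ·V u)) +V (c ·V lincomb L ds)  ≡⟨ ·V-distribˡ c _ _ ⟨
      c ·V ((d ·V u) +V lincomb L ds)         ∎)
    where open ≡-Reasoning

  span-cancelˡ : ∀ {L w v} → Span L (w +V v) → Span L w → Span L v
  span-cancelˡ w+v w = subst (Span _) (-1·V-cancelˡ _ _) (span-+V (span-·V (⊖ 1#) w) w+v)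

  span-∷ : ∀ {L x} u → Span L x → Span (u ∷ L) x
  span-∷ u (mkSpan cs eq) = mkSpan (0# ∷ cs) (trans (cong₂ _+V_ (·V-zeroˡ u) eq) (+V-identityˡ _))

  span-∷⁺ : ∀ {L y} u a → Span L y → Span (u ∷ L) ((a ·V u) +V y)
  span-∷⁺ u a (mkSpan cs eq) = mkSpan (a ∷ cs) (cong ((a ·V u) +V_) eq)

  span-∷⁻ : ∀ {L x} u → Span (u ∷ L) x → ∃ λ a → ∃ λ y → Span L y × x ≡ (a ·V u) +V y
  span-∷⁻ {L} u (mkSpan (a ∷ cs) eq) = a , lincomb L cs , mkSpan cs refl , sym eq

  span-∈ : ∀ {L x} → x ∈ L → Span L x
  span-∈ {u ∷ L} (here refl) =
    subst (Span (u ∷ L)) (trans (cong (_+V 0V) (·V-identityˡ u)) (+V-identityʳ u))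
      (span-∷⁺ u 1# (span-0V L))
  span-∈ {u ∷ L} (there x∈L) = span-∷ u (span-∈ x∈L)

  span-++⁻ : ∀ L {M v} → Span (L ++ M) v → ∃ λ x → ∃ λ y → Span L x × Span M y × v ≡ x +V y
  span-++⁻ []      {v = v} v∈M = 0V , v , span-0V [] , v∈M , sym (+V-identityˡ v)
  span-++⁻ (u ∷ L) v∈
    with a , w , w∈ , refl ← span-∷⁻ u v∈
    with x , y , x∈L , y∈M , refl ← span-++⁻ L w∈ =
      (a ·V u) +V x , y , span-∷⁺ u a x∈L , y∈M , sym (+V-assoc _ x y)

  infix 4 _⊑_
  _⊑_ : List V → List V → Set
  L ⊑ M = All (Span M) L

  span-mono : ∀ {L M x} → L ⊑ M → Span L x → Span M x
  span-mono {[]}    {M} []          (mkSpan [] refl)       = span-0V M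
  span-mono {u ∷ L}     (u∈M ∷ L⊑M) (mkSpan (c ∷ cs) refl) =
    span-+V (span-·V c u∈M) (span-mono L⊑M (mkSpan cs refl))

  ⊑-refl : ∀ {L} → L ⊑ L
  ⊑-refl = All.tabulate span-∈

  ⊑-trans : ∀ {L M N} → L ⊑ M → M ⊑ N → L ⊑ N
  ⊑-trans L⊑M M⊑N = All.map (span-mono M⊑N) L⊑M

  ∷-upper : ∀ {L} u → L ⊑ u ∷ L
  ∷-upper u = All.tabulate (span-∈ ∘ there)

  ++-upperˡ : ∀ L M → L ⊑ L ++ M
  ++-upperˡ L M = All.tabulate (span-∈ ∘ ∈-++⁺ˡ)

  ++-upperʳ : ∀ L M → M ⊑ L ++ M
  ++-upperʳ L M = All.tabulate (span-∈ ∘ ∈-++⁺ʳ L)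

  ++-mono : ∀ {L L′ M M′} → L ⊑ L′ → M ⊑ M′ → L ++ M ⊑ L′ ++ M′
  ++-mono {L′ = L′} {M′ = M′} L⊑L′ M⊑M′ =
    ++⁺ (⊑-trans L⊑L′ (++-upperˡ L′ M′)) (⊑-trans M⊑M′ (++-upperʳ L′ M′))

  ++-interchange : ∀ L M N O → (L ++ M) ++ (N ++ O) ⊑ (L ++ N) ++ (M ++ O)
  ++-interchange L M N O =
    ++⁺ (++-mono (++-upperˡ L N) (++-upperˡ M O)) (++-mono (++-upperʳ L N) (++-upperʳ M O))

  allVecs-complete : ∀ {m} (v : Vec Carrier m) → v ∈ allVecs m
  allVecs-complete []       = here refl
  allVecs-complete {suc m} (x ∷ xs) =
    ∈-concatMap⁺ (λ y → map (y ∷_) (allVecs m))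
      (Any.map (λ { refl → ∈-map⁺ (x ∷_) (allVecs-complete xs) }) (enum-complete x))

  inSpan⇒Span : ∀ L v → inSpan L v ≡ true → Span L v
  inSpan⇒Span L v eq
    with cs , found ← Any.satisfied (any⁻ (λ cs → does (lincomb L cs ≟V v)) (allVecs (length L))
                                            (Equivalence.from T-≡ eq))
    with lincomb L cs ≟V v
  ... | yes lincomb≡v = mkSpan cs lincomb≡v
  ... | no _          = ⊥-elim found

  Span⇒inSpan : ∀ {L v} → Span L v → inSpan L v ≡ true
  Span⇒inSpan {L} {v} (mkSpan cs eq) =
    Equivalence.to T-≡ (any⁺ (λ cs → does (lincomb L cs ≟V v))
      (lose (allVecs-complete cs) (Equivalence.from T-≡ (dec-true (lincomb L cs ≟V v) eq))))

  span? : ∀ L v → Dec (Span L v)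
  span? L v =
    map′ (inSpan⇒Span L v ∘ Equivalence.to T-≡) (Equivalence.from T-≡ ∘ Span⇒inSpan) (T? (inSpan L v))

  infixr 5 _∷ᵢ_
  data Independent : List V → Set where
    []ᵢ  : Independent []
    _∷ᵢ_ : ∀ {v L} → ¬ Span L v → Independent L → Independent (v ∷ L)

  Independent-dropMiddle : ∀ X Y {Z} → Independent (X ++ Y ++ Z) → Independent (X ++ Z)
  Independent-dropMiddle []      []      ind          = ind
  Independent-dropMiddle []      (_ ∷ Y) (_ ∷ᵢ ind)   = Independent-dropMiddle [] Y ind
  Independent-dropMiddle (x ∷ X) Y {Z} (x∉ ∷ᵢ ind) =
    x∉ ∘ span-mono (++-mono (⊑-refl {X}) (++-upperʳ Y Z)) ∷ᵢ Independent-dropMiddle X Y ind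

  exchange : ∀ {S v} s → Span (s ∷ S) v → ¬ Span S v → Span (v ∷ S) s
  exchange {S} s v∈ v∉ with c , y , y∈S , refl ← span-∷⁻ s v∈ with c ≟ 0#
  ... | yes refl =
    ⊥-elim (v∉ (subst (Span S) (sym (trans (cong (_+V y) (·V-zeroˡ s)) (+V-identityˡ y))) y∈S))
  ... | no c≢0 =
    span-cancelˡ (subst (Span _) rescale (span-·V c⁻¹ (span-∈ (here refl))))
                 (span-∷ _ (span-·V c⁻¹ y∈S))
    where
      c⁻¹ = inv c c≢0
      rescale : c⁻¹ ·V ((c ·V s) +V y) ≡ (c⁻¹ ·V y) +V s
      rescale = begin
        c⁻¹ ·V ((c ·V s) +V y)           ≡⟨ ·V-distribˡ c⁻¹ _ y ⟩
        (c⁻¹ ·V (c ·V s)) +V (c⁻¹ ·V y)  ≡⟨ cong (_+V (c⁻¹ ·V y)) (·V-assoc c⁻¹ c s) ⟩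
        ((c⁻¹ ⊗ c) ·V s) +V (c⁻¹ ·V y)   ≡⟨ cong (λ a → (a ·V s) +V (c⁻¹ ·V y))
                                              (trans (R.*-comm c⁻¹ c) (inv-correct c c≢0)) ⟩
        (1# ·V s) +V (c⁻¹ ·V y)          ≡⟨ cong (_+V (c⁻¹ ·V y)) (·V-identityˡ s) ⟩
        s +V (c⁻¹ ·V y)                  ≡⟨ +V-comm s _ ⟩
        (c⁻¹ ·V y) +V s                  ∎
        where open ≡-Reasoning

  -- The exchange step of Steinitz's lemma: I gives up one vector and lands in span S.
  -- The fields u, s∈⟨u∷S⟩, u∈⟨I⟩ and I′⊑I form the invariant that lets a replacement
  -- be built one vector of I at a time.
  record Replacement (s : V) (S I : List V) : Set where
    field
      u              : V
      I′             : List V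
      I′-independent : Independent I′
      I′⊑S           : I′ ⊑ S
      length-I       : length I ≡ suc (length I′)
      s∈⟨u∷S⟩        : Span (u ∷ S) s
      u∈⟨I⟩          : Span I u
      I′⊑I           : I′ ⊑ I

  replacement-start : ∀ {s S v I} → I ⊑ S → Independent I →
                      Span (s ∷ S) v → ¬ Span S v → Replacement s S (v ∷ I)
  replacement-start {s} {v = v} I⊑S I-ind v∈ v∉S = record
    { u = v ; I′ = _ ; I′-independent = I-ind ; I′⊑S = I⊑S ; length-I = refl
    ; s∈⟨u∷S⟩ = exchange s v∈ v∉S ; u∈⟨I⟩ = span-∈ (here refl) ; I′⊑I = ∷-upper v
    }

  replacement-∷ : ∀ {s S v I} → ¬ Span I v → Span (s ∷ S) v →
                  Replacement s S I → Replacement s S (v ∷ I)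
  replacement-∷ {s} {S} {v} {I} v∉I v∈ ρ@record { u = u ; s∈⟨u∷S⟩ = s∈⟨u∷S⟩ }
    with a , y , y∈S , v≡ ← span-∷⁻ u (span-mono (s∈⟨u∷S⟩ ∷ ∷-upper u) v∈) = record
    { u = u ; I′ = y ∷ I′ ; I′-independent = y∉I′ ∷ᵢ I′-independent ; I′⊑S = y∈S ∷ I′⊑S
    ; length-I = cong suc length-I ; s∈⟨u∷S⟩ = s∈⟨u∷S⟩ ; u∈⟨I⟩ = span-∷ v u∈⟨I⟩
    ; I′⊑I = y∈⟨v∷I⟩ ∷ ⊑-trans I′⊑I (∷-upper v)
    }
    where
      open Replacement ρ hiding (u; s∈⟨u∷S⟩)
      y∉I′ : ¬ Span I′ y
      y∉I′ y∈I′ =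
        v∉I (span-mono (u∈⟨I⟩ ∷ I′⊑I) (subst (Span (u ∷ I′)) (sym v≡) (span-∷⁺ u a y∈I′)))
      y∈⟨v∷I⟩ : Span (v ∷ I) y
      y∈⟨v∷I⟩ =
        span-cancelˡ (subst (Span (v ∷ I)) v≡ (span-∈ (here refl))) (span-·V a (span-∷ v u∈⟨I⟩))

  replace : ∀ s S {I} → Independent I → I ⊑ s ∷ S → I ⊑ S ⊎ Replacement s S I
  replace s S []ᵢ [] = inj₁ []
  replace s S (v∉I ∷ᵢ I-ind) (v∈ ∷ I⊑) with replace s S I-ind I⊑
  ... | inj₂ ρ   = inj₂ (replacement-∷ v∉I v∈ ρ)
  ... | inj₁ I⊑S with span? S _
  ...   | yes v∈S = inj₁ (v∈S ∷ I⊑S)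
  ...   | no v∉S  = inj₂ (replacement-start I⊑S I-ind v∈ v∉S)

  steinitz : ∀ S {I} → Independent I → I ⊑ S → length I ℕ.≤ length S
  steinitz []      []ᵢ         []         = ℕ.z≤n
  steinitz []      (v∉ ∷ᵢ _)   (v∈ ∷ _)   = ⊥-elim (v∉ (span-mono [] v∈))
  steinitz (s ∷ S) I-ind       I⊑ with replace s S I-ind I⊑
  ... | inj₁ I⊑S = ℕ.m≤n⇒m≤1+n (steinitz S I-ind I⊑S)
  ... | inj₂ ρ   =
    subst (ℕ._≤ suc (length S)) (sym length-I) (ℕ.s≤s (steinitz S I′-independent I′⊑S))
    where open Replacement ρ

  greedy-independent : ∀ {acc} L → Independent acc → Independent (greedyBasis acc L)
  greedy-independent []      acc-ind = acc-ind
  greedy-independent {acc} (v ∷ L) acc-ind with inSpan acc v in eq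
  ... | true  = greedy-independent L acc-ind
  ... | false = greedy-independent L (v∉acc ∷ᵢ acc-ind)
    where
      v∉acc : ¬ Span acc v
      v∉acc v∈acc = case trans (sym eq) (Span⇒inSpan v∈acc) of λ ()

  greedy-extends : ∀ acc L → ∃ λ E → greedyBasis acc L ≡ E ++ acc × E ⊑ L
  greedy-extends acc []      = [] , refl , []
  greedy-extends acc (v ∷ L) with inSpan acc v
  ... | true  with E , eq , E⊑L ← greedy-extends acc L = E , eq , ⊑-trans E⊑L (∷-upper v)
  ... | false with E , eq , E⊑L ← greedy-extends (v ∷ acc) L =
    E ++ v ∷ [] , trans eq (sym (++-assoc E (v ∷ []) acc)) ,
    ++⁺ (⊑-trans E⊑L (∷-upper v)) (span-∈ (here refl) ∷ [])

  greedy-⊑ : ∀ acc L → greedyBasis acc L ⊑ acc ++ L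
  greedy-⊑ acc L with E , eq , E⊑L ← greedy-extends acc L =
    subst (_⊑ acc ++ L) (sym eq) (++⁺ (⊑-trans E⊑L (++-upperʳ acc L)) (++-upperˡ acc L))

  greedy-spans : ∀ acc L → acc ⊑ greedyBasis acc L × L ⊑ greedyBasis acc L
  greedy-spans acc []      = ⊑-refl , []
  greedy-spans acc (v ∷ L) with inSpan acc v in eq
  ... | true  with acc⊑ , L⊑ ← greedy-spans acc L =
    acc⊑ , span-mono acc⊑ (inSpan⇒Span acc v eq) ∷ L⊑
  ... | false with v∷acc⊑ , L⊑ ← greedy-spans (v ∷ acc) L =
    ⊑-trans (∷-upper v) v∷acc⊑ , All.head v∷acc⊑ ∷ L⊑

  basis : Subspace → List V
  basis A = greedyBasis [] (gens A)

  basis-independent : ∀ A → Independent (basis A)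
  basis-independent A = greedy-independent (gens A) []ᵢ

  basis⊑gens : ∀ A → basis A ⊑ gens A
  basis⊑gens A = greedy-⊑ [] (gens A)

  gens⊑basis : ∀ A → gens A ⊑ basis A
  gens⊑basis A = proj₂ (greedy-spans [] (gens A))

  dim≡length : ∀ A {I} → Independent I → I ⊑ gens A → gens A ⊑ I → dim A ≡ length I
  dim≡length A {I} I-ind I⊑A A⊑I = ℕ.≤-antisym
    (steinitz I (basis-independent A) (⊑-trans (basis⊑gens A) A⊑I))
    (steinitz (basis A) I-ind (⊑-trans I⊑A (gens⊑basis A)))

  dim-mono : ∀ A B → gens A ⊑ gens B → dim A ℕ.≤ dim B
  dim-mono A B A⊑B =
    steinitz (basis B) (basis-independent A) (⊑-trans (basis⊑gens A) (⊑-trans A⊑B (gens⊑basis B)))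

  dim≡length-greedy : ∀ A acc L → Independent acc → gens A ⊑ acc ++ L → acc ++ L ⊑ gens A →
                      dim A ≡ length (greedyBasis acc L)
  dim≡length-greedy A acc L acc-ind A⊑ ⊑A with acc⊑ , L⊑ ← greedy-spans acc L =
    dim≡length A (greedy-independent L acc-ind)
      (⊑-trans (greedy-⊑ acc L) ⊑A) (⊑-trans A⊑ (++⁺ acc⊑ L⊑))

  ⊆⇒⊑ : ∀ A B → A ⊆ B → gens A ⊑ gens B
  ⊆⇒⊑ A B A⊆B =
    All.tabulate λ {v} v∈A → inSpan⇒Span (gens B) v (A⊆B v (Span⇒inSpan (span-∈ v∈A)))

  ∈-∩S⁻ : ∀ A B {v} → v ∈ gens (A ∩S B) → Span (gens A) v × Span (gens B) v
  ∈-∩S⁻ A B {v} v∈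
    with v∈A , v∈B ← Equivalence.to T-∧
                       (proj₂ (∈-filter⁻ (λ v → T? (mem A v ∧ mem B v)) {xs = allVecs n} v∈)) =
      inSpan⇒Span (gens A) v (Equivalence.to T-≡ v∈A) , inSpan⇒Span (gens B) v (Equivalence.to T-≡ v∈B)

  span-∩S⁺ : ∀ A B {v} → Span (gens A) v → Span (gens B) v → Span (gens (A ∩S B)) v
  span-∩S⁺ A B v∈A v∈B = span-∈ (∈-filter⁺ (λ v → T? (mem A v ∧ mem B v)) (allVecs-complete _)
    (Equivalence.from T-∧ (Equivalence.from T-≡ (Span⇒inSpan v∈A) ,
                           Equivalence.from T-≡ (Span⇒inSpan v∈B))))

  ∩S-lowerˡ : ∀ A B → gens (A ∩S B) ⊑ gens A
  ∩S-lowerˡ A B = All.tabulate (proj₁ ∘ ∈-∩S⁻ A B)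

  ∩S-lowerʳ : ∀ A B → gens (A ∩S B) ⊑ gens B
  ∩S-lowerʳ A B = All.tabulate (proj₂ ∘ ∈-∩S⁻ A B)

  ∩S-greatest : ∀ {L} A B → L ⊑ gens A → L ⊑ gens B → L ⊑ gens (A ∩S B)
  ∩S-greatest A B L⊑A L⊑B = All.zipWith (uncurry (span-∩S⁺ A B)) (L⊑A , L⊑B)

  -- If y = x + p with x ∈ span E ⊆ B and p ∈ A, then p = y − x also lies in B, hence in A ∩ B.
  complement-spans : ∀ A B {E G} → G ⊑ gens A → E ⊑ gens B → gens B ⊑ E ++ G →
                     gens B ⊑ E ++ basis (A ∩S B)
  complement-spans A B {E} {G} G⊑A E⊑B B⊑E++G =
    All.tabulate λ y∈B → split (span-∈ y∈B) (All.lookup B⊑E++G y∈B)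
    where
      split : ∀ {y} → Span (gens B) y → Span (E ++ G) y → Span (E ++ basis (A ∩S B)) y
      split y∈B y∈E++G with x , p , x∈E , p∈G , refl ← span-++⁻ E y∈E++G =
        span-+V (span-mono (++-upperˡ E _) x∈E) (span-mono (++-upperʳ E _) p∈A∩B)
        where
          p∈A∩B : Span (basis (A ∩S B)) p
          p∈A∩B = span-mono (gens⊑basis (A ∩S B))
            (span-∩S⁺ A B (span-mono G⊑A p∈G) (span-cancelˡ y∈B (span-mono E⊑B x∈E)))

  dim-+S-∩S : ∀ A B → dim (A +S B) ℕ.+ dim (A ∩S B) ≡ dim A ℕ.+ dim B
  dim-+S-∩S A B
    with EA , GA≡ , _ ← greedy-extends (basis (A ∩S B)) (gens A)
    with EB , GAB≡ , EB⊑B ← greedy-extends (greedyBasis (basis (A ∩S B)) (gens A)) (gens B) = begin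
      dim (A +S B) ℕ.+ length C               ≡⟨ cong (ℕ._+ length C) (trans dim[A+B] (cong length GAB≡)) ⟩
      length (EB ++ GA) ℕ.+ length C          ≡⟨ cong (ℕ._+ length C) (length-++ EB) ⟩
      (length EB ℕ.+ length GA) ℕ.+ length C  ≡⟨ cong (ℕ._+ length C) (ℕ.+-comm (length EB) _) ⟩
      (length GA ℕ.+ length EB) ℕ.+ length C  ≡⟨ ℕ.+-assoc (length GA) _ _ ⟩
      length GA ℕ.+ (length EB ℕ.+ length C)  ≡⟨ cong₂ ℕ._+_ dim[A] (trans dim[B] (length-++ EB)) ⟨
      dim A ℕ.+ dim B                         ∎
    where
      open ≡-Reasoning
      C  = basis (A ∩S B)
      GA = greedyBasis C (gens A)
      C⊑A : C ⊑ gens A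
      C⊑A = ⊑-trans (basis⊑gens (A ∩S B)) (∩S-lowerˡ A B)
      C⊑B : C ⊑ gens B
      C⊑B = ⊑-trans (basis⊑gens (A ∩S B)) (∩S-lowerʳ A B)
      GA-independent : Independent GA
      GA-independent = greedy-independent (gens A) (basis-independent (A ∩S B))
      GA⊑A : GA ⊑ gens A
      GA⊑A = ⊑-trans (greedy-⊑ C (gens A)) (++⁺ C⊑A ⊑-refl)
      dim[A] : dim A ≡ length GA
      dim[A] = dim≡length-greedy A C (gens A) (basis-independent (A ∩S B))
        (++-upperʳ C (gens A)) (++⁺ C⊑A ⊑-refl)
      dim[A+B] : dim (A +S B) ≡ length (greedyBasis GA (gens B))
      dim[A+B] = dim≡length-greedy (A +S B) GA (gens B) GA-independent
        (++-mono (proj₂ (greedy-spans C (gens A))) ⊑-refl) (++-mono GA⊑A ⊑-refl)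
      EB++C-independent : Independent (EB ++ C)
      EB++C-independent = Independent-dropMiddle EB EA
        (subst Independent (trans GAB≡ (cong (EB ++_) GA≡)) (greedy-independent (gens B) GA-independent))
      dim[B] : dim B ≡ length (EB ++ C)
      dim[B] = dim≡length B EB++C-independent (++⁺ EB⊑B C⊑B)
        (complement-spans A B GA⊑A EB⊑B (subst (gens B ⊑_) GAB≡ (proj₂ (greedy-spans GA (gens B)))))

  dimQuot-+S≤dim : ∀ A B → dimQuot (A +S B) B ℕ.≤ dim A
  dimQuot-+S≤dim A B = ℕ.m≤n+o⇒m∸n≤o (dim (A +S B)) (dim B) (begin
    dim (A +S B)                        ≤⟨ ℕ.m≤m+n _ _ ⟩
    dim (A +S B) ℕ.+ dim (A ∩S B)       ≡⟨ dim-+S-∩S A B ⟩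
    dim A ℕ.+ dim B                     ≡⟨ ℕ.+-comm (dim A) _ ⟩
    dim B ℕ.+ dim A                     ∎)
    where open ℕ.≤-Reasoning

  dim[X+J]+dim[K]≤dim[X+K]+dim[J] : ∀ X K J → gens K ⊑ gens J →
                                    dim (X +S J) ℕ.+ dim K ℕ.≤ dim (X +S K) ℕ.+ dim J
  dim[X+J]+dim[K]≤dim[X+K]+dim[J] X K J K⊑J = begin
    dim (X +S J) ℕ.+ dim K                        ≤⟨ ℕ.+-mono-≤ X+J≤ K≤ ⟩
    dim ((X +S K) +S J) ℕ.+ dim ((X +S K) ∩S J)   ≡⟨ dim-+S-∩S (X +S K) J ⟩
    dim (X +S K) ℕ.+ dim J                        ∎
    where
      open ℕ.≤-Reasoning
      X+J≤ = dim-mono (X +S J) ((X +S K) +S J) (++-mono (++-upperˡ (gens X) (gens K)) ⊑-refl)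
      K≤   = dim-mono K ((X +S K) ∩S J) (∩S-greatest (X +S K) J (++-upperʳ (gens X) (gens K)) K⊑J)

  dim-join-meet : ∀ A B F G J M →
    gens F ⊑ gens J → gens G ⊑ gens J → gens M ⊑ gens F → gens M ⊑ gens G →
    dim ((A +S B) +S J) ℕ.+ dim ((A ∩S B) +S M) ℕ.+ (dim F ℕ.+ dim G)
      ℕ.≤ dim (A +S F) ℕ.+ dim (B +S G) ℕ.+ (dim (F ∩S G) ℕ.+ dim J)
  dim-join-meet A B F G J M F⊑J G⊑J M⊑F M⊑G = ℕ.+-cancelʳ-≤ (dim (F +S G)) _ _ (begin
    dim A+B+J ℕ.+ dim A∩B+M ℕ.+ (dim F ℕ.+ dim G) ℕ.+ dim (F +S G)
      ≡⟨ cong (λ t → dim A+B+J ℕ.+ dim A∩B+M ℕ.+ t ℕ.+ dim (F +S G)) (dim-+S-∩S F G) ⟨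
    dim A+B+J ℕ.+ dim A∩B+M ℕ.+ (dim (F +S G) ℕ.+ dim (F ∩S G)) ℕ.+ dim (F +S G)
      ≡⟨ regroup₁ (dim A+B+J) (dim A∩B+M) (dim (F +S G)) (dim (F ∩S G)) ⟩
    (dim A+B+J ℕ.+ dim (F +S G)) ℕ.+ dim A∩B+M ℕ.+ (dim (F ∩S G) ℕ.+ dim (F +S G))
      ≤⟨ ℕ.+-monoˡ-≤ _ (ℕ.+-mono-≤ A+B+J≤ A∩B+M≤) ⟩
    (dim A+B+F+G ℕ.+ dim J) ℕ.+ dim A∩B+F∩G ℕ.+ (dim (F ∩S G) ℕ.+ dim (F +S G))
      ≡⟨ regroup₂ (dim A+B+F+G) (dim J) (dim A∩B+F∩G) (dim (F ∩S G)) (dim (F +S G)) ⟩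
    (dim A+B+F+G ℕ.+ dim A∩B+F∩G) ℕ.+ (dim (F ∩S G) ℕ.+ dim J) ℕ.+ dim (F +S G)
      ≤⟨ ℕ.+-monoˡ-≤ _ (ℕ.+-monoˡ-≤ _ A+B+F+G≤) ⟩
    dim (A +S F) ℕ.+ dim (B +S G) ℕ.+ (dim (F ∩S G) ℕ.+ dim J) ℕ.+ dim (F +S G) ∎)
    where
      open ℕ.≤-Reasoning
      A+B+J = (A +S B) +S J
      A∩B+M = (A ∩S B) +S M
      A+B+F+G = (A +S B) +S (F +S G)
      A∩B+F∩G = (A ∩S B) +S (F ∩S G)
      A+B+J≤ : dim A+B+J ℕ.+ dim (F +S G) ℕ.≤ dim A+B+F+G ℕ.+ dim J
      A+B+J≤ = dim[X+J]+dim[K]≤dim[X+K]+dim[J] (A +S B) (F +S G) J (++⁺ F⊑J G⊑J)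
      A∩B+M≤ : dim A∩B+M ℕ.≤ dim A∩B+F∩G
      A∩B+M≤ = dim-mono A∩B+M A∩B+F∩G (++-mono ⊑-refl (∩S-greatest F G M⊑F M⊑G))
      A+F = A +S F
      B+G = B +S G
      A+B+F+G≤ : dim A+B+F+G ℕ.+ dim A∩B+F∩G ℕ.≤ dim A+F ℕ.+ dim B+G
      A+B+F+G≤ = begin
        dim A+B+F+G ℕ.+ dim A∩B+F∩G            ≤⟨ ℕ.+-mono-≤
          (dim-mono A+B+F+G (A+F +S B+G) (++-interchange (gens A) (gens B) (gens F) (gens G)))
          (dim-mono A∩B+F∩G (A+F ∩S B+G) (∩S-greatest A+F B+G
            (++-mono (∩S-lowerˡ A B) (∩S-lowerˡ F G))
            (++-mono (∩S-lowerʳ A B) (∩S-lowerʳ F G)))) ⟩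
        dim (A+F +S B+G) ℕ.+ dim (A+F ∩S B+G)  ≡⟨ dim-+S-∩S A+F B+G ⟩
        dim A+F ℕ.+ dim B+G                    ∎
      regroup₁ : ∀ a b s i → a ℕ.+ b ℕ.+ (s ℕ.+ i) ℕ.+ s ≡ (a ℕ.+ s) ℕ.+ b ℕ.+ (i ℕ.+ s)
      regroup₁ = solve-∀
      regroup₂ : ∀ x j y i s → (x ℕ.+ j) ℕ.+ y ℕ.+ (i ℕ.+ s) ≡ (x ℕ.+ y) ℕ.+ (i ℕ.+ j) ℕ.+ s
      regroup₂ = solve-∀

module LatticeRank (K : FiniteField) (n : ℕ) where
  open VS K n
  open LinearAlgebra K n

  lattice-lowerBound : ∀ {Z} → IsLattice Z → ∀ F Fs → F ∈Z Z → All (_∈Z Z) Fs →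
                       ∃ λ B → B ∈Z Z × All (B ⊆_) (F ∷ Fs)
  lattice-lowerBound lattice F []        F∈Z []            = F , F∈Z , (λ _ v∈F → v∈F) ∷ []
  lattice-lowerBound lattice F (F′ ∷ Fs) F∈Z (F′∈Z ∷ Fs∈Z)
    with B , B∈Z , B⊆ ← lattice-lowerBound lattice F′ Fs F′∈Z Fs∈Z
    with _ , (M , M∈Z , M⊆F , M⊆B , _) ← lattice F B F∈Z B∈Z =
      M , M∈Z , M⊆F ∷ All.map (λ B⊆H v → B⊆H v ∘ M⊆B v) B⊆

  lattice-bottom : ∀ Z → IsLattice Z → Σ Subspace (IsBottom Z)
  lattice-bottom (F ∷ Fs) lattice
    with B , B∈Z , B⊆ ← lattice-lowerBound lattice F Fs (here refl) (All.tabulate there) =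
      B , B∈Z , λ H H∈Z → All.lookup B⊆ H∈Z

  module _ (r : Subspace → ℤ) (Z : List⁺ Subspace) where

    bound : Subspace → Subspace → ℤ
    bound A F = r F + + dimQuot (A +S F) F

    rZ≤bound : ∀ A {F} → F ∈Z Z → rZ r Z A ≤ bound A F
    rZ≤bound A F∈Z = foldr₁-⊓-≤ (bound A (List⁺.head Z)) _ (∈-map⁺ (bound A) F∈Z)

    rZ-attained : ∀ A → ∃ λ F → F ∈Z Z × rZ r Z A ≡ bound A F
    rZ-attained A = ∈-map⁻ (bound A) (foldr₁-⊓-∈ (bound A (List⁺.head Z)) _)

    rZ-nonneg : (∀ F → + 0 ≤ r F) → ∀ A → + 0 ≤ rZ r Z A
    rZ-nonneg r≥0 A with F , _ , rZ≡ ← rZ-attained A =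
      subst (+ 0 ≤_) (sym rZ≡) (ℤ.+-mono-≤ (r≥0 F) (+≤+ ℕ.z≤n))

    rZ≤dim : ∀ {B} → B ∈Z Z → r B ≡ + 0 → ∀ A → rZ r Z A ≤ + dim A
    rZ≤dim {B} B∈Z rB≡0 A = ℤ.≤-trans (rZ≤bound A B∈Z)
      (subst (λ t → t + + dimQuot (A +S B) B ≤ + dim A) (sym rB≡0) (+≤+ (dimQuot-+S≤dim A B)))

    rZ-mono : ∀ A B → A ⊆ B → rZ r Z A ≤ rZ r Z B
    rZ-mono A B A⊆B with F , F∈Z , rZ≡ ← rZ-attained B =
      subst (rZ r Z A ≤_) (sym rZ≡) (ℤ.≤-trans (rZ≤bound A F∈Z) (ℤ.+-monoʳ-≤ (r F) (+≤+
        (ℕ.∸-monoˡ-≤ (dim F) (dim-mono (A +S F) (B +S F) (++-mono (⊆⇒⊑ A B A⊆B) ⊑-refl))))))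

    +dimQuot : ∀ X F → gens F ⊑ gens X → + dimQuot X F ≡ + dim X - + dim F
    +dimQuot X F F⊑X = trans (sym (ℤ.⊖-≥ (dim-mono F X F⊑X))) (sym (ℤ.m-n≡m⊖n (dim X) (dim F)))

    bound≡ : ∀ A F → bound A F ≡ r F + (+ dim (A +S F) - + dim F)
    bound≡ A F = cong (λ d → r F + d) (+dimQuot (A +S F) F (++-upperʳ (gens A) (gens F)))

    bound-join-meet : ∀ A B F G J M → F ⊆ J → G ⊆ J → M ⊆ F → M ⊆ G →
      r J + r M + + dimQuot (F ∩S G) M ≤ r F + r G →
      bound (A +S B) J + bound (A ∩S B) M ≤ bound A F + bound B G
    bound-join-meet A B F G J M F⊆J G⊆J M⊆F M⊆G z3 = begin
      bound (A +S B) J + bound (A ∩S B) M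
        ≡⟨ cong₂ _+_ (bound≡ (A +S B) J) (bound≡ (A ∩S B) M) ⟩
      (r J + (δ ((A +S B) +S J) - δ J)) + (r M + (δ ((A ∩S B) +S M) - δ M))
        ≤⟨ arithmetic (r F) (r G) (r J) (r M) (δ ((A +S B) +S J)) (δ ((A ∩S B) +S M)) (δ F) (δ G)
                      (δ (A +S F)) (δ (B +S G)) (δ (F ∩S G)) (δ J) (δ M)
                      z3′ (+≤+ (dim-join-meet A B F G J M F⊑J G⊑J M⊑F M⊑G)) ⟩
      (r F + (δ (A +S F) - δ F)) + (r G + (δ (B +S G) - δ G))
        ≡⟨ cong₂ _+_ (bound≡ A F) (bound≡ B G) ⟨
      bound A F + bound B G ∎
      where
        open ℤ.≤-Reasoning
        δ : Subspace → ℤ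
        δ X = + dim X
        F⊑J = ⊆⇒⊑ F J F⊆J
        G⊑J = ⊆⇒⊑ G J G⊆J
        M⊑F = ⊆⇒⊑ M F M⊆F
        M⊑G = ⊆⇒⊑ M G M⊆G
        z3′ : r J + r M + (δ (F ∩S G) - δ M) ≤ r F + r G
        z3′ = subst (λ t → r J + r M + t ≤ r F + r G)
                    (+dimQuot (F ∩S G) M (∩S-greatest F G M⊑F M⊑G)) z3
        arithmetic : ∀ rF rG rJ rM a b f g p q i j m →
          rJ + rM + (i - m) ≤ rF + rG → a + b + (f + g) ≤ p + q + (i + j) →
          (rJ + (a - j)) + (rM + (b - m)) ≤ (rF + (p - f)) + (rG + (q - g))
        arithmetic rF rG rJ rM a b f g p q i j m h₁ h₂ =
          ℤ.0≤i-j⇒j≤i (subst (0ℤ ≤_) (regroup rF rG rJ rM a b f g p q i j m)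
            (ℤ.+-mono-≤ (ℤ.i≤j⇒0≤j-i h₁) (ℤ.i≤j⇒0≤j-i h₂)))
          where
            regroup : ∀ rF rG rJ rM a b f g p q i j m →
              (rF + rG - (rJ + rM + (i - m))) + (p + q + (i + j) - (a + b + (f + g)))
                ≡ (rF + (p - f)) + (rG + (q - g)) - ((rJ + (a - j)) + (rM + (b - m)))
            regroup = ℤ-Solver.solve-∀

    rZ-submodular : IsLattice Z →
      (∀ F G J M → F ∈Z Z → G ∈Z Z → IsJoin Z F G J → IsMeet Z F G M →
        r J + r M + + dimQuot (F ∩S G) M ≤ r F + r G) →
      ∀ A B → rZ r Z (A +S B) + rZ r Z (A ∩S B) ≤ rZ r Z A + rZ r Z B
    rZ-submodular lattice z3 A B
      with F , F∈Z , rZ[A]≡ ← rZ-attained A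
      with G , G∈Z , rZ[B]≡ ← rZ-attained B
      with (J , join@(J∈Z , F⊆J , G⊆J , _)) , (M , meet@(M∈Z , M⊆F , M⊆G , _))
             ← lattice F G F∈Z G∈Z = begin
        rZ r Z (A +S B) + rZ r Z (A ∩S B)
          ≤⟨ ℤ.+-mono-≤ (rZ≤bound (A +S B) J∈Z) (rZ≤bound (A ∩S B) M∈Z) ⟩
        bound (A +S B) J + bound (A ∩S B) M
          ≤⟨ bound-join-meet A B F G J M F⊆J G⊆J M⊆F M⊆G (z3 F G J M F∈Z G∈Z join meet) ⟩
        bound A F + bound B G
          ≡⟨ cong₂ _+_ rZ[A]≡ rZ[B]≡ ⟨
        rZ r Z A + rZ r Z B ∎
      where open ℤ.≤-Reasoning

proposition3p8 : (K : FiniteField) (n : ℕ) →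
    let open VS K n in
    (r : Subspace → ℤ) → Extensional r → IsQMatroid r →
    (Z : List⁺ Subspace) → IsLattice Z →
    -- (Z1)
    (∀ B → IsBottom Z B → r B ≡ + 0) →
    -- (Z2)
    (∀ F G → F ∈Z Z → G ∈Z Z → G ⊂ F →
      (+ 0 < r F - r G) × (r F - r G < + dim F - + dim G)) →
    -- (Z3)
    (∀ F G J M → F ∈Z Z → G ∈Z Z → IsJoin Z F G J → IsMeet Z F G M →
      r J + r M + + dimQuot (F ∩S G) M ≤ r F + r G) →
    IsQMatroid (rZ r Z)
proposition3p8 K n r _ r-isQMatroid Z lattice z1 _ z3
  with B , bottom@(B∈Z , _) ← LatticeRank.lattice-bottom K n Z lattice = record
    { R1 = λ A → rZ-nonneg r Z (proj₁ ∘ R1) A , rZ≤dim r Z B∈Z (z1 B bottom) A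
    ; R2 = rZ-mono r Z
    ; R3 = rZ-submodular r Z lattice z3
    }
  where
    open LatticeRank K n
    open VS K n using (module IsQMatroid)
    open IsQMatroid r-isQMatroid
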